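{- Let $G=(V,E)$ be a graph with a smooth tree-decomposition $(X,T)$ of width $k$, let $C=\{1,\dots,c\}$, and let $X_i$ be an internal node of $T$ with children $X_L,X_R$, where $X_L=X_i$, $X_i\setminus X_R=\{v'\}$ and $X_R\setminus X_i=\{v''\}$. Let $f:E_i'\to C$ be a partial coloring of $G_i'$, and let $f_L=f|_{E_L'}$, $f_R=f|_{E_R'}$. Fix $(c_1,c_2)\in C^2$ and put $A^{(j)}=N^{(j)}_f(c_1,c_2)$ (computed in $G_i'$ relative to $X_i$), $A_L^{(j)}=N^{(j)}_{f_L}(c_1,c_2)$ (computed in $G_L'$ relative to $X_L$) and $A_R^{(j)}=N^{(j)}_{f_R}(c_1,c_2)$ (computed in $G_R'$ relative to $X_R$), for $1\le j\le 9$. Let $\bar A^{(j)}$, $1\le j\le 9$, be the sets defined from $(A_L^{(j)})_j$ and $(A_R^{(j)})_j$ as in the context. Then for every $1\le j\le 9$, $$A^{(j)}=\big(A_L^{(j)}\cup A_R^{(j)}\cup \bar A^{(j)}\big)-\{v''\},$$ where for $j\in\{3,8,9\}$ (sets of ordered pairs) "$-\{v''\}$" means removing all pairs having $v''$ as a coordinate.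
   Context: Tree-decomposition: a pair $(X,T)$, $T$ a tree with node set $I$, $X=\{X_i:i\in I\}$ subsets of $V$ with $\bigcup X_i=V$, every edge having both ends in some $X_i$, and $X_i\cap X_s\subseteq X_j$ whenever $j$ is on the $T$-path from $i$ to $s$. It is smooth of width $k$ if $T$ is a binary tree, $|X_i|=k+1$ for all $i$, every internal node has exactly two children one of which has the same bag as the node, $k\le |X_i\cap X_j|\le k+1$ for every tree edge $ij$, and every edge $uv\in E$ has both ends in the bag of at least one leaf. For each edge $e$ choose a leaf $rep(e)$ whose bag contains both ends of $e$. For a leaf $X_i$: $V_i=X_i$ and $E_i'=\{e\in E: rep(e)=i\}$; for an internal node with children $X_L,X_R$: $V_i=V_L\cup V_R$, $E_i'=E_L'\cup E_R'$. $G_i'$ is the graph $(V_i,E_i')$. A partial coloring of $G_i'$ is any map $f:E_i'\to C$. For a partial coloring $f$ of $G_i'$ and $(c_1,c_2)\in C^2$ define (all edges taken in $E_i'$): $N^{(1)}_f=\{v_0\in X_i:\exists v_0v_1,v_1v_2\in E_i',\ f(v_0v_1)=c_1,f(v_1v_2)=c_2\}$; $N^{(2)}_f=\{v_0\in X_i:\exists v_0v_1,v_1v_2\in E_i',\ f(v_0v_1)=c_2,f(v_1v_2)=c_1\}$; $N^{(3)}_f=\{(v_0,v_2)\in X_i^2:\exists v_0v_1,v_1v_2\in E_i',\ f(v_0v_1)=c_1,f(v_1v_2)=c_2\}$; $N^{(4)}_f=\{v_0\in X_i:\exists v_0v_1,v_1v_2,v_2v_3\in E_i',\ f(v_0v_1)=c_1,f(v_1v_2)=c_2,f(v_2v_3)=c_1\}$;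 $N^{(5)}_f=\{v_0\in X_i:\exists v_0v_1,v_1v_2,v_2v_3\in E_i',\ f(v_0v_1)=c_2,f(v_1v_2)=c_1,f(v_2v_3)=c_2\}$; $N^{(6)}_f=\{v_0\in X_i:\exists v_0v\in E_i',\ f(v_0v)=c_1\}$; $N^{(7)}_f=\{v_0\in X_i:\exists v_0v\in E_i',\ f(v_0v)=c_2\}$; $N^{(8)}_f=\{(v_0,v_1)\in X_i^2: v_0v_1\in E_i',\ f(v_0v_1)=c_1\}$; $N^{(9)}_f=\{(v_0,v_1)\in X_i^2: v_0v_1\in E_i',\ f(v_0v_1)=c_2\}$. Given tuples $(A_L^{(j)})_{1\le j\le 9}$ and $(A_R^{(j)})_{1\le j\le 9}$, define: $\bar A^{(1)}=\{v_0:(v_0,v_1)\in A_L^{(8)},v_1\in A_R^{(7)}\}\cup\{v_0:(v_0,v_1)\in A_R^{(8)},v_1\in A_L^{(7)}\}$; $\bar A^{(2)}=\{v_0:(v_0,v_1)\in A_L^{(9)},v_1\in A_R^{(6)}\}\cup\{v_0:(v_0,v_1)\in A_R^{(9)},v_1\in A_L^{(6)}\}$; $\bar A^{(3)}=\{(v_1,v_2):\exists v_3,(v_1,v_3)\in A_L^{(8)},(v_3,v_2)\in A_R^{(9)}\}\cup\{(v_1,v_2):\exists v_3,(v_1,v_3)\in A_R^{(8)},(v_3,v_2)\in A_L^{(9)}\}$; $\bar A^{(4)}$ is the union of $\{v_0:\exists v_1,(v_0,v_1)\in A_L^{(3)},v_1\in A_R^{(6)}\}$, $\{v_0:\exists v_1,v_2,(v_0,v_1)\in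 A_L^{(8)},(v_1,v_2)\in A_R^{(9)},v_2\in A_L^{(6)}\}$, $\{v_0:\exists v_1,(v_0,v_1)\in A_L^{(8)},v_1\in A_R^{(2)}\}$, and the three sets obtained from these by interchanging $L$ and $R$; $\bar A^{(5)}$ is the union of $\{v_0:\exists v_1,(v_1,v_0)\in A_L^{(3)},v_1\in A_R^{(7)}\}$, $\{v_0:\exists v_1,v_2,(v_0,v_1)\in A_L^{(9)},(v_1,v_2)\in A_R^{(8)},v_2\in A_L^{(7)}\}$, $\{v_0:\exists v_1,(v_0,v_1)\in A_L^{(9)},v_1\in A_R^{(1)}\}$, and the three sets obtained from these by interchanging $L$ and $R$; $\bar A^{(j)}=\emptyset$ for $6\le j\le 9$. -}

module Defs where

open import Data.Nat using (ℕ; suc; _≤_)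
open import Data.Fin using (Fin)
open import Data.Fin.Subset using (Subset; _∈_; _∩_; ∣_∣)
open import Data.Product using (Σ; ∃; _×_; _,_; proj₁; proj₂)
open import Data.Sum using (_⊎_)
open import Relation.Binary.PropositionalEquality using (_≡_; _≢_)
open import Function.Bundles using (_⇔_)

Ends : {n m : ℕ} → (Fin m → Fin n × Fin n) → Fin m → Fin n → Fin n → Set
Ends ends e a b = (ends e ≡ (a , b)) ⊎ (ends e ≡ (b , a))

record IsSimpleGraph {n m : ℕ} (ends : Fin m → Fin n × Fin n) : Set where
  field
    loopless : ∀ e → proj₁ (ends e) ≢ proj₂ (ends e)
    noParallel : ∀ e e' → Ends ends e' (proj₁ (ends e)) (proj₂ (ends e)) → e ≡ e'

data Tree (n : ℕ) : Set where
  leaf : Subset n → Tree n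
  node : Subset n → Tree n → Tree n → Tree n

bag : {n : ℕ} → Tree n → Subset n
bag (leaf x) = x
bag (node x _ _) = x

-- Nodes of the tree (the index set I): positions, read from the root.
data Pos {n : ℕ} : Tree n → Set where
  here  : ∀ {t} → Pos t
  left  : ∀ {x l r} → Pos l → Pos (node x l r)
  right : ∀ {x l r} → Pos r → Pos (node x l r)

subAt : {n : ℕ} {t : Tree n} → Pos t → Tree n
subAt {t = t} here = t
subAt (left p) = subAt p
subAt (right p) = subAt p

bagAt : {n : ℕ} {t : Tree n} → Pos t → Subset n
bagAt p = bag (subAt p)

extend : {n : ℕ} {t : Tree n} (p : Pos t) → Pos (subAt p) → Pos t
extend here q = q
extend (left p) q = left (extend p q)
extend (right p) q = right (extend p q)

IsLeafTree : {n : ℕ} → Tree n → Set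
IsLeafTree (leaf _) = Data.Unit.⊤ where import Data.Unit
IsLeafTree (node _ _ _) = Data.Empty.⊥ where import Data.Empty

IsLeaf : {n : ℕ} {t : Tree n} → Pos t → Set
IsLeaf p = IsLeafTree (subAt p)

data _≼_ {n : ℕ} : {t : Tree n} → Pos t → Pos t → Set where
  here≼  : ∀ {t} {q : Pos t} → here ≼ q
  left≼  : ∀ {x l r} {p q : Pos l} → p ≼ q → _≼_ {t = node x l r} (left p) (left q)
  right≼ : ∀ {x l r} {p q : Pos r} → p ≼ q → _≼_ {t = node x l r} (right p) (right q)

-- j lies on the (unique) T-path from i to s: j is an ancestor of i or
-- of s, and j lies below the lowest common ancestor of i and s.
OnPath : {n : ℕ} {t : Tree n} → Pos t → Pos t → Pos t → Set
OnPath {t = t} j i s = ((j ≼ i) ⊎ (j ≼ s)) × (∀ (a : Pos t) → a ≼ i → a ≼ s → a ≼ j)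

data ChildOf {n : ℕ} : {t : Tree n} → Pos t → Pos t → Set where
  cl : ∀ {x l r} → ChildOf {t = node x l r} (left here) here
  cr : ∀ {x l r} → ChildOf {t = node x l r} (right here) here
  ul : ∀ {x l r} {c p : Pos l} → ChildOf c p → ChildOf {t = node x l r} (left c) (left p)
  ur : ∀ {x l r} {c p : Pos r} → ChildOf c p → ChildOf {t = node x l r} (right c) (right p)

record IsTreeDecomposition {n m : ℕ} (ends : Fin m → Fin n × Fin n) (T : Tree n) : Set where
  field
    covers : ∀ (v : Fin n) → Σ (Pos T) λ i → v ∈ bagAt i
    edgeCovered : ∀ (e : Fin m) → Σ (Pos T) λ i →
      (proj₁ (ends e) ∈ bagAt i) × (proj₂ (ends e) ∈ bagAt i)
    pathCondition : ∀ (i j s : Pos T) → OnPath j i s →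
      ∀ (v : Fin n) → v ∈ bagAt i → v ∈ bagAt s → v ∈ bagAt j

-- the per-node smoothness conditions (binary tree is built into Tree)
SmoothTree : {n : ℕ} → ℕ → Tree n → Set
SmoothTree k (leaf x) = ∣ x ∣ ≡ suc k
SmoothTree k (node x l r) =
  (∣ x ∣ ≡ suc k)
  × ((bag l ≡ x) ⊎ (bag r ≡ x))
  × (k ≤ ∣ x ∩ bag l ∣) × (∣ x ∩ bag l ∣ ≤ suc k)
  × (k ≤ ∣ x ∩ bag r ∣) × (∣ x ∩ bag r ∣ ≤ suc k)
  × SmoothTree k l × SmoothTree k r

record IsSmoothTreeDecomposition {n m : ℕ} (ends : Fin m → Fin n × Fin n)
                                 (k : ℕ) (T : Tree n) : Set where
  field
    isTD : IsTreeDecomposition ends T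
    smooth : SmoothTree k T
    edgeInLeaf : ∀ (e : Fin m) → Σ (Pos T) λ i → IsLeaf i ×
      (proj₁ (ends e) ∈ bagAt i) × (proj₂ (ends e) ∈ bagAt i)

record IsRep {n m : ℕ} (ends : Fin m → Fin n × Fin n) (T : Tree n)
             (rep : Fin m → Pos T) : Set where
  field
    repLeaf : ∀ e → IsLeaf (rep e)
    repBag  : ∀ e → (proj₁ (ends e) ∈ bagAt (rep e)) × (proj₂ (ends e) ∈ bagAt (rep e))

-- E'_i, defined recursively as in the paper:
-- leaf i : E'_i = {e : rep(e) = i};  internal : E'_i = E'_L ∪ E'_R.

E'go : {n m : ℕ} {T : Tree n} (rep : Fin m → Pos T) →
       (t : Tree n) → (Pos t → Pos T) → Fin m → Set
E'go rep (leaf x) emb e = rep e ≡ emb here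
E'go rep (node x l r) emb e =
  E'go rep l (λ q → emb (left q)) e ⊎ E'go rep r (λ q → emb (right q)) e

E' : {n m : ℕ} {T : Tree n} (rep : Fin m → Pos T) → Pos T → Fin m → Set
E' rep i = E'go rep (subAt i) (extend i)

-- partial colorings of G'_i with colours C = Fin c (i.e. {1,…,c} relabelled)
PartialColoring : {m : ℕ} → (Fin m → Set) → ℕ → Set
PartialColoring {m} Ei c = (e : Fin m) → Ei e → Fin c

record Tuple (n : ℕ) : Set₁ where
  field
    a1 a2 : Fin n → Set
    a3    : Fin n → Fin n → Set
    a4 a5 a6 a7 : Fin n → Set
    a8 a9 : Fin n → Fin n → Set

module _ {n m c : ℕ} (ends : Fin m → Fin n × Fin n)
         (X : Subset n) (Ei : Fin m → Set) (f : PartialColoring Ei c) where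

  Col : Fin c → Fin n → Fin n → Set
  Col col a b = Σ (Fin m) λ e → Σ (Ei e) λ h → Ends ends e a b × (f e h ≡ col)

  N : Fin c → Fin c → Tuple n
  N c₁ c₂ = record
    { a1 = λ v₀ → v₀ ∈ X × ∃ λ v₁ → ∃ λ v₂ → Col c₁ v₀ v₁ × Col c₂ v₁ v₂
    ; a2 = λ v₀ → v₀ ∈ X × ∃ λ v₁ → ∃ λ v₂ → Col c₂ v₀ v₁ × Col c₁ v₁ v₂
    ; a3 = λ v₀ v₂ → v₀ ∈ X × v₂ ∈ X × ∃ λ v₁ → Col c₁ v₀ v₁ × Col c₂ v₁ v₂
    ; a4 = λ v₀ → v₀ ∈ X × ∃ λ v₁ → ∃ λ v₂ → ∃ λ v₃ →
             Col c₁ v₀ v₁ × Col c₂ v₁ v₂ × Col c₁ v₂ v₃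
    ; a5 = λ v₀ → v₀ ∈ X × ∃ λ v₁ → ∃ λ v₂ → ∃ λ v₃ →
             Col c₂ v₀ v₁ × Col c₁ v₁ v₂ × Col c₂ v₂ v₃
    ; a6 = λ v₀ → v₀ ∈ X × ∃ λ v → Col c₁ v₀ v
    ; a7 = λ v₀ → v₀ ∈ X × ∃ λ v → Col c₂ v₀ v
    ; a8 = λ v₀ v₁ → v₀ ∈ X × v₁ ∈ X × Col c₁ v₀ v₁
    ; a9 = λ v₀ v₁ → v₀ ∈ X × v₁ ∈ X × Col c₂ v₀ v₁
    }

module _ {n : ℕ} where
  open Tuple

  bar1 bar2 bar4 bar5 : Tuple n → Tuple n → Fin n → Set
  bar3 : Tuple n → Tuple n → Fin n → Fin n → Set

  bar1 L R v₀ = ∃ λ v₁ → a8 L v₀ v₁ × a7 R v₁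
  bar2 L R v₀ = ∃ λ v₁ → a9 L v₀ v₁ × a6 R v₁
  bar3 L R v₁ v₂ = ∃ λ v₃ → a8 L v₁ v₃ × a9 R v₃ v₂
  bar4 L R v₀ =
      (∃ λ v₁ → a3 L v₀ v₁ × a6 R v₁)
    ⊎ (∃ λ v₁ → ∃ λ v₂ → a8 L v₀ v₁ × a9 R v₁ v₂ × a6 L v₂)
    ⊎ (∃ λ v₁ → a8 L v₀ v₁ × a2 R v₁)
  bar5 L R v₀ =
      (∃ λ v₁ → a3 L v₁ v₀ × a7 R v₁)
    ⊎ (∃ λ v₁ → ∃ λ v₂ → a9 L v₀ v₁ × a8 R v₁ v₂ × a7 L v₂)
    ⊎ (∃ λ v₁ → a9 L v₀ v₁ × a1 R v₁)

  Bar : Tuple n → Tuple n → Tuple n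
  Bar L R = record
    { a1 = λ v → bar1 L R v ⊎ bar1 R L v
    ; a2 = λ v → bar2 L R v ⊎ bar2 R L v
    ; a3 = λ u w → bar3 L R u w ⊎ bar3 R L u w
    ; a4 = λ v → bar4 L R v ⊎ bar4 R L v
    ; a5 = λ v → bar5 L R v ⊎ bar5 R L v
    ; a6 = λ _ → Data.Empty.⊥
    ; a7 = λ _ → Data.Empty.⊥
    ; a8 = λ _ _ → Data.Empty.⊥
    ; a9 = λ _ _ → Data.Empty.⊥
    }
    where import Data.Empty

  EqMinus1 : (Fin n → Set) → (Fin n → Set) → (Fin n → Set) → (Fin n → Set) → Fin n → Set
  EqMinus1 A AL AR Ab v'' = ∀ v → A v ⇔ ((AL v ⊎ AR v ⊎ Ab v) × v ≢ v'')

  EqMinus2 : (Fin n → Fin n → Set) → (Fin n → Fin n → Set) → (Fin n → Fin n → Set) →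
             (Fin n → Fin n → Set) → Fin n → Set
  EqMinus2 A AL AR Ab v'' = ∀ u w →
    A u w ⇔ ((AL u w ⊎ AR u w ⊎ Ab u w) × u ≢ v'' × w ≢ v'')

  Recurrence : (A AL AR : Tuple n) → Fin n → Set
  Recurrence A AL AR v'' =
      EqMinus1 (a1 A) (a1 AL) (a1 AR) (a1 B) v''
    × EqMinus1 (a2 A) (a2 AL) (a2 AR) (a2 B) v''
    × EqMinus2 (a3 A) (a3 AL) (a3 AR) (a3 B) v''
    × EqMinus1 (a4 A) (a4 AL) (a4 AR) (a4 B) v''
    × EqMinus1 (a5 A) (a5 AL) (a5 AR) (a5 B) v''
    × EqMinus1 (a6 A) (a6 AL) (a6 AR) (a6 B) v''
    × EqMinus1 (a7 A) (a7 AL) (a7 AR) (a7 B) v''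
    × EqMinus2 (a8 A) (a8 AL) (a8 AR) (a8 B) v''
    × EqMinus2 (a9 A) (a9 AL) (a9 AR) (a9 B) v''
    where B = Bar AL AR

module Submission where

-- Every edge of G'_i lies in G'_L or in G'_R, and only the path condition of the
-- tree-decomposition is needed to locate the vertices where a coloured walk of
-- G'_i switches between the two.  An end in X_i of an edge of G'_R lies in X_R,
-- because the representative leaf of the edge lies below R, which lies between
-- that leaf and i.  A vertex shared by an edge of G'_L and an edge of G'_R lies
-- in X_i, because the path between their representative leaves passes through i;
-- as X_L = X_i it then lies in X_L ∩ X_R.  Cutting a walk of length at most three
-- at these switching vertices gives exactly the patterns collected in A_L, A_R
-- and Ā; conversely each pattern glues back to a walk of G'_i.  Finally
-- X_L ∪ (X_R − {v''}) = X_i, which accounts for the removal of v''.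

open import Defs
open import Data.Nat using (ℕ)
open import Data.Fin using (Fin)
open import Data.Fin.Subset using (Subset; _─_; ⁅_⁆; _∈_; _∉_; inside; outside)
open import Data.Fin.Subset.Properties using (_∈?_; x∈⁅x⁆; x∈⁅y⁆⇒x≡y; x∈p∧x∉q⇒x∈p─q)
open import Data.Vec.Base using (_∷_; here; there)
open import Data.Product using (_×_; ∃; _,_; proj₁; proj₂; map₁)
open import Data.Sum using (_⊎_; inj₁; inj₂; map₂)
open import Data.Empty using (⊥; ⊥-elim)
open import Function using (_∘_; id)
open import Function.Bundles using (_⇔_; mk⇔; Equivalence)
open import Relation.Nullary using (yes; no)
open import Relation.Binary.PropositionalEquality using (_≡_; _≢_; refl; sym; trans; cong; subst)

x∈p─q⇒x∉q : ∀ {n} {x : Fin n} {p q : Subset n} → x ∈ p ─ q → x ∉ q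
x∈p─q⇒x∉q {p = inside ∷ _} {q = outside ∷ _} here ()
x∈p─q⇒x∉q {p = _ ∷ _} {q = _ ∷ _} (there x∈p─q) (there x∈q) = x∈p─q⇒x∉q x∈p─q x∈q

module _ {n : ℕ} where

  ≼-trans : ∀ {t : Tree n} {a b d : Pos t} → a ≼ b → b ≼ d → a ≼ d
  ≼-trans here≼      _          = here≼
  ≼-trans (left≼ p)  (left≼ q)  = left≼ (≼-trans p q)
  ≼-trans (right≼ p) (right≼ q) = right≼ (≼-trans p q)

  ≼-extend : ∀ {t : Tree n} (p : Pos t) (q : Pos (subAt p)) → p ≼ extend p q
  ≼-extend here      q = here≼
  ≼-extend (left p)  q = left≼ (≼-extend p q)
  ≼-extend (right p) q = right≼ (≼-extend p q)

  ChildOf⇒≼ : ∀ {t : Tree n} {d i : Pos t} → ChildOf d i → i ≼ d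
  ChildOf⇒≼ cl      = here≼
  ChildOf⇒≼ cr      = here≼
  ChildOf⇒≼ (ul ch) = left≼ (ChildOf⇒≼ ch)
  ChildOf⇒≼ (ur ch) = right≼ (ChildOf⇒≼ ch)

  ≼-comparable : ∀ {t : Tree n} {a b x : Pos t} → a ≼ x → b ≼ x → a ≼ b ⊎ b ≼ a
  ≼-comparable here≼      _          = inj₁ here≼
  ≼-comparable (left≼ p)  here≼      = inj₂ here≼
  ≼-comparable (right≼ p) here≼      = inj₂ here≼
  ≼-comparable (left≼ p)  (left≼ q)  = Data.Sum.map left≼ left≼ (≼-comparable p q)
  ≼-comparable (right≼ p) (right≼ q) = Data.Sum.map right≼ right≼ (≼-comparable p q)

  ≼-child : ∀ {t : Tree n} {a d i : Pos t} → ChildOf d i → a ≼ d → a ≡ d ⊎ a ≼ i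
  ≼-child cl      here≼              = inj₂ here≼
  ≼-child cl      (left≼ here≼)      = inj₁ refl
  ≼-child cr      here≼              = inj₂ here≼
  ≼-child cr      (right≼ here≼)     = inj₁ refl
  ≼-child (ul ch) here≼              = inj₂ here≼
  ≼-child (ur ch) here≼              = inj₂ here≼
  ≼-child (ul ch) (left≼ p)  = Data.Sum.map (cong left)  left≼  (≼-child ch p)
  ≼-child (ur ch) (right≼ p) = Data.Sum.map (cong right) right≼ (≼-child ch p)

  ChildOf-≼⇒≡ : ∀ {t : Tree n} {a b i : Pos t} → ChildOf a i → ChildOf b i → a ≼ b → a ≡ b
  ChildOf-≼⇒≡ cl     cl     _          = refl
  ChildOf-≼⇒≡ cr     cr     _          = refl
  ChildOf-≼⇒≡ (ul x) (ul y) (left≼ p)  = cong left  (ChildOf-≼⇒≡ x y p)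
  ChildOf-≼⇒≡ (ur x) (ur y) (right≼ p) = cong right (ChildOf-≼⇒≡ x y p)

  siblings-no-common-descendant : ∀ {t : Tree n} {a b i x : Pos t} →
    ChildOf a i → ChildOf b i → a ≢ b → a ≼ x → b ≼ x → ⊥
  siblings-no-common-descendant a∈i b∈i a≢b a≼x b≼x with ≼-comparable a≼x b≼x
  ... | inj₁ a≼b = a≢b (ChildOf-≼⇒≡ a∈i b∈i a≼b)
  ... | inj₂ b≼a = a≢b (sym (ChildOf-≼⇒≡ b∈i a∈i b≼a))

  OnPath-child : ∀ {t : Tree n} {d i x : Pos t} → ChildOf d i → d ≼ x → OnPath d x i
  OnPath-child d∈i d≼x = inj₁ d≼x , λ _ _ a≼i → ≼-trans a≼i (ChildOf⇒≼ d∈i)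

  OnPath-siblings : ∀ {t : Tree n} {i L R x y : Pos t} →
    ChildOf L i → ChildOf R i → L ≢ R → L ≼ x → R ≼ y → OnPath i x y
  OnPath-siblings {i = i} {L} {R} {x} {y} L∈i R∈i L≢R L≼x R≼y =
    inj₁ (≼-trans (ChildOf⇒≼ L∈i) L≼x) , common
    where
    disjoint : ∀ {z} → L ≼ z → R ≼ z → ⊥
    disjoint = siblings-no-common-descendant L∈i R∈i L≢R

    common : ∀ a → a ≼ x → a ≼ y → a ≼ i
    common a a≼x a≼y with ≼-comparable a≼x L≼x
    ... | inj₂ L≼a = ⊥-elim (disjoint (≼-trans L≼a a≼y) R≼y)
    ... | inj₁ a≼L with ≼-child L∈i a≼L
    ...   | inj₂ a≼i = a≼i
    ...   | inj₁ refl = ⊥-elim (disjoint a≼y R≼y)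

module _ {n m : ℕ} {T : Tree n} (rep : Fin m → Pos T) where

  E'go-rep : ∀ (t : Tree n) (emb : Pos t → Pos T) {e} → E'go rep t emb e → ∃ λ q → rep e ≡ emb q
  E'go-rep (leaf _)     emb h        = here , h
  E'go-rep (node _ l r) emb (inj₁ h) = Data.Product.map left id (E'go-rep l (emb ∘ left) h)
  E'go-rep (node _ l r) emb (inj₂ h) = Data.Product.map right id (E'go-rep r (emb ∘ right) h)

  E'go-child⊆ : ∀ {t : Tree n} (emb : Pos t → Pos T) {d i : Pos t} → ChildOf d i → ∀ {e} →
    E'go rep (subAt d) (emb ∘ extend d) e → E'go rep (subAt i) (emb ∘ extend i) e
  E'go-child⊆ emb cl      h = inj₁ h
  E'go-child⊆ emb cr      h = inj₂ h
  E'go-child⊆ emb (ul ch) h = E'go-child⊆ (emb ∘ left) ch h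
  E'go-child⊆ emb (ur ch) h = E'go-child⊆ (emb ∘ right) ch h

  E'go-split : ∀ {t : Tree n} (emb : Pos t → Pos T) {L R i : Pos t} →
    ChildOf L i → ChildOf R i → L ≢ R → ∀ {e} →
    E'go rep (subAt i) (emb ∘ extend i) e →
    E'go rep (subAt L) (emb ∘ extend L) e ⊎ E'go rep (subAt R) (emb ∘ extend R) e
  E'go-split emb cl     cl     L≢R h        = ⊥-elim (L≢R refl)
  E'go-split emb cr     cr     L≢R h        = ⊥-elim (L≢R refl)
  E'go-split emb cl     cr     L≢R h        = h
  E'go-split emb cr     cl     L≢R (inj₁ h) = inj₂ h
  E'go-split emb cr     cl     L≢R (inj₂ h) = inj₁ h
  E'go-split emb (ul x) (ul y) L≢R h = E'go-split (emb ∘ left)  x y (L≢R ∘ cong left)  h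
  E'go-split emb (ur x) (ur y) L≢R h = E'go-split (emb ∘ right) x y (L≢R ∘ cong right) h

  E'-child⊆ : ∀ {d i : Pos T} → ChildOf d i → ∀ {e} → E' rep d e → E' rep i e
  E'-child⊆ = E'go-child⊆ (λ q → q)

  E'-split : ∀ {L R i : Pos T} → ChildOf L i → ChildOf R i → L ≢ R →
    ∀ {e} → E' rep i e → E' rep L e ⊎ E' rep R e
  E'-split = E'go-split (λ q → q)

  E'⇒≼rep : ∀ (p : Pos T) {e} → E' rep p e → p ≼ rep e
  E'⇒≼rep p h with E'go-rep (subAt p) (extend p) h
  ... | q , rep≡ = subst (p ≼_) (sym rep≡) (≼-extend p q)

module _ {n m : ℕ} {ends : Fin m → Fin n × Fin n} where

  Ends⇒∈ : ∀ {e a b} {S : Subset n} → Ends ends e a b →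
    proj₁ (ends e) ∈ S × proj₂ (ends e) ∈ S → a ∈ S × b ∈ S
  Ends⇒∈ {S = S} (inj₁ eq) (p , q) = subst (_∈ S) (cong proj₁ eq) p , subst (_∈ S) (cong proj₂ eq) q
  Ends⇒∈ {S = S} (inj₂ eq) (p , q) = subst (_∈ S) (cong proj₂ eq) q , subst (_∈ S) (cong proj₁ eq) p

  module _ {c : ℕ} {X : Subset n} {Ei : Fin m → Set} {f : PartialColoring Ei c} where

    Col-sym : ∀ {col a b} → Col ends X Ei f col a b → Col ends X Ei f col b a
    Col-sym (e , h , inj₁ eq , fe) = e , h , inj₂ eq , fe
    Col-sym (e , h , inj₂ eq , fe) = e , h , inj₁ eq , fe

    a3-reverse : ∀ {x y u w} → Tuple.a3 (N ends X Ei f x y) u w → Tuple.a3 (N ends X Ei f y x) w u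
    a3-reverse (u∈ , w∈ , v , p , q) = w∈ , u∈ , v , Col-sym q , Col-sym p

-- Ā^(5) for (c₁, c₂) is Ā^(4) for (c₂, c₁), up to reading a path of A^(3) backwards.
module _ {n m c : ℕ} {ends : Fin m → Fin n × Fin n}
         {X Y : Subset n} {E F : Fin m → Set}
         {f : PartialColoring E c} {g : PartialColoring F c} (x y : Fin c) where

  bar5⇒bar4-swap : ∀ {v} → bar5 (N ends X E f x y) (N ends Y F g x y) v →
                          bar4 (N ends X E f y x) (N ends Y F g y x) v
  bar5⇒bar4-swap (inj₁ (v₁ , p , q)) = inj₁ (v₁ , a3-reverse p , q)
  bar5⇒bar4-swap (inj₂ b)            = inj₂ b

  bar4-swap⇒bar5 : ∀ {v} → bar4 (N ends X E f y x) (N ends Y F g y x) v →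
                          bar5 (N ends X E f x y) (N ends Y F g x y) v
  bar4-swap⇒bar5 (inj₁ (v₁ , p , q)) = inj₁ (v₁ , a3-reverse p , q)
  bar4-swap⇒bar5 (inj₂ b)            = inj₂ b

module _ {n : ℕ} {A AL AR Ā : Fin n → Set} {v'' : Fin n} where

  EqMinus1-intro : (∀ {v} → A v → v ≢ v'') →
    (∀ {v} → A v → AL v ⊎ AR v ⊎ Ā v) →
    (∀ {v} → AL v ⊎ AR v ⊎ Ā v → v ≢ v'' → A v) →
    EqMinus1 A AL AR Ā v''
  EqMinus1-intro A≢ split join v = mk⇔ (λ a → split a , A≢ a) (λ (b , v≢) → join b v≢)

  EqMinus1-congĀ : ∀ {Ā'} → (∀ v → Ā v ⇔ Ā' v) → EqMinus1 A AL AR Ā v'' → EqMinus1 A AL AR Ā' v''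
  EqMinus1-congĀ Ā⇔Ā' eq v = mk⇔
    (map₁ (map₂ (map₂ (Equivalence.to (Ā⇔Ā' v))))   ∘ Equivalence.to (eq v))
    (Equivalence.from (eq v) ∘ map₁ (map₂ (map₂ (Equivalence.from (Ā⇔Ā' v)))))

EqMinus2-intro : ∀ {n} {A AL AR Ā : Fin n → Fin n → Set} {v'' : Fin n} →
  (∀ {u w} → A u w → u ≢ v'' × w ≢ v'') →
  (∀ {u w} → A u w → AL u w ⊎ AR u w ⊎ Ā u w) →
  (∀ {u w} → AL u w ⊎ AR u w ⊎ Ā u w → u ≢ v'' → w ≢ v'' → A u w) →
  EqMinus2 A AL AR Ā v''
EqMinus2-intro A≢ split join u w = mk⇔ (λ a → split a , A≢ a) (λ (b , u≢ , w≢) → join b u≢ w≢)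

module InternalNode
  {n m c : ℕ} {ends : Fin m → Fin n × Fin n} {T : Tree n}
  (td : IsTreeDecomposition ends T) {rep : Fin m → Pos T} (isRep : IsRep ends T rep)
  {i L R : Pos T} (L∈i : ChildOf L i) (R∈i : ChildOf R i) (L≢R : L ≢ R) {v'' : Fin n}
  (XL≡Xi : bagAt L ≡ bagAt i) (XR─Xi≡v'' : bagAt R ─ bagAt i ≡ ⁅ v'' ⁆)
  {f : PartialColoring (E' rep i) c}
  {fL : PartialColoring (E' rep L) c} {fR : PartialColoring (E' rep R) c}
  (fL≗f : ∀ e hL hi → fL e hL ≡ f e hi) (fR≗f : ∀ e hR hi → fR e hR ≡ f e hi) where

  open IsTreeDecomposition td using (pathCondition)
  open IsRep isRep using (repBag)
  open Tuple

  Xi XL XR : Subset n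
  Xi = bagAt i
  XL = bagAt L
  XR = bagAt R

  ColI ColL ColR : Fin c → Fin n → Fin n → Set
  ColI = Col ends Xi (E' rep i) f
  ColL = Col ends XL (E' rep L) fL
  ColR = Col ends XR (E' rep R) fR

  Xi⇒XL : ∀ {a} → a ∈ Xi → a ∈ XL
  Xi⇒XL {a} = subst (a ∈_) (sym XL≡Xi)

  XL⇒Xi : ∀ {a} → a ∈ XL → a ∈ Xi
  XL⇒Xi {a} = subst (a ∈_) XL≡Xi

  Xi⇒≢v'' : ∀ {a} → a ∈ Xi → a ≢ v''
  Xi⇒≢v'' a∈Xi refl = x∈p─q⇒x∉q (subst (v'' ∈_) (sym XR─Xi≡v'') (x∈⁅x⁆ v'')) a∈Xi

  XR⇒Xi : ∀ {a} → a ∈ XR → a ≢ v'' → a ∈ Xi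
  XR⇒Xi {a} a∈XR a≢v'' with a ∈? Xi
  ... | yes a∈Xi = a∈Xi
  ... | no  a∉Xi = ⊥-elim (a≢v'' (x∈⁅y⁆⇒x≡y v'' (subst (a ∈_) XR─Xi≡v'' (x∈p∧x∉q⇒x∈p─q a∈XR a∉Xi))))

  liftL : ∀ {col a b} → ColL col a b → ColI col a b
  liftL (e , h , ab , fe) = e , E'-child⊆ rep L∈i h , ab , trans (sym (fL≗f e h _)) fe

  liftR : ∀ {col a b} → ColR col a b → ColI col a b
  liftR (e , h , ab , fe) = e , E'-child⊆ rep R∈i h , ab , trans (sym (fR≗f e h _)) fe

  splitI : ∀ {col a b} → ColI col a b → ColL col a b ⊎ ColR col a b
  splitI (e , h , ab , fe) with E'-split rep L∈i R∈i L≢R h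
  ... | inj₁ hL = inj₁ (e , hL , ab , trans (fL≗f e hL h) fe)
  ... | inj₂ hR = inj₂ (e , hR , ab , trans (fR≗f e hR h) fe)

  start∈XR : ∀ {col a b} → ColR col a b → a ∈ Xi → a ∈ XR
  start∈XR (e , h , ab , _) a∈Xi =
    pathCondition (rep e) R i (OnPath-child R∈i (E'⇒≼rep rep R h)) _
      (proj₁ (Ends⇒∈ {ends = ends} ab (repBag e))) a∈Xi

  end∈XR : ∀ {col a b} → ColR col a b → b ∈ Xi → b ∈ XR
  end∈XR = start∈XR ∘ Col-sym {X = XR}

  junctionLR : ∀ {col col' a b d} → ColL col a b → ColR col' b d → b ∈ Xi
  junctionLR (e , h , ab , _) (e' , h' , bd , _) =
    pathCondition (rep e) i (rep e')
      (OnPath-siblings L∈i R∈i L≢R (E'⇒≼rep rep L h) (E'⇒≼rep rep R h')) _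
      (proj₂ (Ends⇒∈ {ends = ends} ab (repBag e))) (proj₁ (Ends⇒∈ {ends = ends} bd (repBag e')))

  junctionRL : ∀ {col col' a b d} → ColR col a b → ColL col' b d → b ∈ Xi
  junctionRL p q = junctionLR (Col-sym {X = XL} q) (Col-sym {X = XR} p)

  AI AL AR Ā : Fin c → Fin c → Tuple n
  AI x y = N ends Xi (E' rep i) f x y
  AL x y = N ends XL (E' rep L) fL x y
  AR x y = N ends XR (E' rep R) fR x y
  Ā  x y = Bar (AL x y) (AR x y)

  module _ (x y : Fin c) where

    split₁ : ∀ {v} → a1 (AI x y) v → a1 (AL x y) v ⊎ a1 (AR x y) v ⊎ a1 (Ā x y) v
    split₁ (v∈ , v₁ , v₂ , p , q) with splitI p | splitI q
    ... | inj₁ p | inj₁ q = inj₁ (Xi⇒XL v∈ , v₁ , v₂ , p , q)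
    ... | inj₂ p | inj₂ q = inj₂ (inj₁ (start∈XR p v∈ , v₁ , v₂ , p , q))
    ... | inj₁ p | inj₂ q = inj₂ (inj₂ (inj₁ (v₁ , (Xi⇒XL v∈ , Xi⇒XL j , p) , (start∈XR q j , v₂ , q))))
      where j = junctionLR p q
    ... | inj₂ p | inj₁ q = inj₂ (inj₂ (inj₂ (v₁ , (start∈XR p v∈ , end∈XR p j , p) , (Xi⇒XL j , v₂ , q))))
      where j = junctionRL p q

    join₁ : ∀ {v} → a1 (AL x y) v ⊎ a1 (AR x y) v ⊎ a1 (Ā x y) v → v ≢ v'' → a1 (AI x y) v
    join₁ (inj₁ (v∈ , v₁ , v₂ , p , q))                      _  = XL⇒Xi v∈ , v₁ , v₂ , liftL p , liftL q
    join₁ (inj₂ (inj₁ (v∈ , v₁ , v₂ , p , q)))               v≢ = XR⇒Xi v∈ v≢ , v₁ , v₂ , liftR p , liftR q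
    join₁ (inj₂ (inj₂ (inj₁ (v₁ , (v∈ , _ , p) , (_ , v₂ , q))))) _  = XL⇒Xi v∈ , v₁ , v₂ , liftL p , liftR q
    join₁ (inj₂ (inj₂ (inj₂ (v₁ , (v∈ , _ , p) , (_ , v₂ , q))))) v≢ = XR⇒Xi v∈ v≢ , v₁ , v₂ , liftR p , liftL q

    eq₁ : EqMinus1 (a1 (AI x y)) (a1 (AL x y)) (a1 (AR x y)) (a1 (Ā x y)) v''
    eq₁ = EqMinus1-intro (Xi⇒≢v'' ∘ proj₁) split₁ join₁

    split₃ : ∀ {u w} → a3 (AI x y) u w → a3 (AL x y) u w ⊎ a3 (AR x y) u w ⊎ a3 (Ā x y) u w
    split₃ (u∈ , w∈ , v₁ , p , q) with splitI p | splitI q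
    ... | inj₁ p | inj₁ q = inj₁ (Xi⇒XL u∈ , Xi⇒XL w∈ , v₁ , p , q)
    ... | inj₂ p | inj₂ q = inj₂ (inj₁ (start∈XR p u∈ , end∈XR q w∈ , v₁ , p , q))
    ... | inj₁ p | inj₂ q =
      inj₂ (inj₂ (inj₁ (v₁ , (Xi⇒XL u∈ , Xi⇒XL j , p) , (start∈XR q j , end∈XR q w∈ , q))))
      where j = junctionLR p q
    ... | inj₂ p | inj₁ q =
      inj₂ (inj₂ (inj₂ (v₁ , (start∈XR p u∈ , end∈XR p j , p) , (Xi⇒XL j , Xi⇒XL w∈ , q))))
      where j = junctionRL p q

    join₃ : ∀ {u w} → a3 (AL x y) u w ⊎ a3 (AR x y) u w ⊎ a3 (Ā x y) u w →
      u ≢ v'' → w ≢ v'' → a3 (AI x y) u w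
    join₃ (inj₁ (u∈ , w∈ , v₁ , p , q)) _ _ = XL⇒Xi u∈ , XL⇒Xi w∈ , v₁ , liftL p , liftL q
    join₃ (inj₂ (inj₁ (u∈ , w∈ , v₁ , p , q))) u≢ w≢ =
      XR⇒Xi u∈ u≢ , XR⇒Xi w∈ w≢ , v₁ , liftR p , liftR q
    join₃ (inj₂ (inj₂ (inj₁ (v₁ , (u∈ , _ , p) , (_ , w∈ , q))))) _ w≢ =
      XL⇒Xi u∈ , XR⇒Xi w∈ w≢ , v₁ , liftL p , liftR q
    join₃ (inj₂ (inj₂ (inj₂ (v₁ , (u∈ , _ , p) , (_ , w∈ , q))))) u≢ _ =
      XR⇒Xi u∈ u≢ , XL⇒Xi w∈ , v₁ , liftR p , liftL q

    eq₃ : EqMinus2 (a3 (AI x y)) (a3 (AL x y)) (a3 (AR x y)) (a3 (Ā x y)) v''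
    eq₃ = EqMinus2-intro (λ a → Xi⇒≢v'' (proj₁ a) , Xi⇒≢v'' (proj₁ (proj₂ a))) split₃ join₃

    split₄ : ∀ {v} → a4 (AI x y) v → a4 (AL x y) v ⊎ a4 (AR x y) v ⊎ a4 (Ā x y) v
    split₄ (v∈ , v₁ , v₂ , v₃ , p , q , r) with splitI p | splitI q | splitI r
    ... | inj₁ p | inj₁ q | inj₁ r = inj₁ (Xi⇒XL v∈ , v₁ , v₂ , v₃ , p , q , r)
    ... | inj₂ p | inj₂ q | inj₂ r = inj₂ (inj₁ (start∈XR p v∈ , v₁ , v₂ , v₃ , p , q , r))
    ... | inj₁ p | inj₁ q | inj₂ r =
      inj₂ (inj₂ (inj₁ (inj₁ (v₂ , (Xi⇒XL v∈ , Xi⇒XL j , v₁ , p , q) , (start∈XR r j , v₃ , r)))))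
      where j = junctionLR q r
    ... | inj₂ p | inj₂ q | inj₁ r =
      inj₂ (inj₂ (inj₂ (inj₁ (v₂ , (start∈XR p v∈ , end∈XR q j , v₁ , p , q) , (Xi⇒XL j , v₃ , r)))))
      where j = junctionRL q r
    ... | inj₁ p | inj₂ q | inj₁ r =
      inj₂ (inj₂ (inj₁ (inj₂ (inj₁ (v₁ , v₂ , (Xi⇒XL v∈ , Xi⇒XL j , p) ,
                                    (start∈XR q j , end∈XR q j' , q) , (Xi⇒XL j' , v₃ , r))))))
      where j = junctionLR p q
            j' = junctionRL q r
    ... | inj₂ p | inj₁ q | inj₂ r =
      inj₂ (inj₂ (inj₂ (inj₂ (inj₁ (v₁ , v₂ , (start∈XR p v∈ , end∈XR p j , p) ,
                                    (Xi⇒XL j , Xi⇒XL j' , q) , (start∈XR r j' , v₃ , r))))))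
      where j = junctionRL p q
            j' = junctionLR q r
    ... | inj₁ p | inj₂ q | inj₂ r =
      inj₂ (inj₂ (inj₁ (inj₂ (inj₂ (v₁ , (Xi⇒XL v∈ , Xi⇒XL j , p) , (start∈XR q j , v₂ , v₃ , q , r))))))
      where j = junctionLR p q
    ... | inj₂ p | inj₁ q | inj₁ r =
      inj₂ (inj₂ (inj₂ (inj₂ (inj₂ (v₁ , (start∈XR p v∈ , end∈XR p j , p) , (Xi⇒XL j , v₂ , v₃ , q , r))))))
      where j = junctionRL p q

    join₄ : ∀ {v} → a4 (AL x y) v ⊎ a4 (AR x y) v ⊎ a4 (Ā x y) v → v ≢ v'' → a4 (AI x y) v
    join₄ (inj₁ (v∈ , v₁ , v₂ , v₃ , p , q , r)) _ =
      XL⇒Xi v∈ , v₁ , v₂ , v₃ , liftL p , liftL q , liftL r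
    join₄ (inj₂ (inj₁ (v∈ , v₁ , v₂ , v₃ , p , q , r))) v≢ =
      XR⇒Xi v∈ v≢ , v₁ , v₂ , v₃ , liftR p , liftR q , liftR r
    join₄ (inj₂ (inj₂ (inj₁ (inj₁ (v₂ , (v∈ , _ , v₁ , p , q) , (_ , v₃ , r)))))) _ =
      XL⇒Xi v∈ , v₁ , v₂ , v₃ , liftL p , liftL q , liftR r
    join₄ (inj₂ (inj₂ (inj₂ (inj₁ (v₂ , (v∈ , _ , v₁ , p , q) , (_ , v₃ , r)))))) v≢ =
      XR⇒Xi v∈ v≢ , v₁ , v₂ , v₃ , liftR p , liftR q , liftL r
    join₄ (inj₂ (inj₂ (inj₁ (inj₂ (inj₁ (v₁ , v₂ , (v∈ , _ , p) , (_ , _ , q) , (_ , v₃ , r))))))) _ =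
      XL⇒Xi v∈ , v₁ , v₂ , v₃ , liftL p , liftR q , liftL r
    join₄ (inj₂ (inj₂ (inj₂ (inj₂ (inj₁ (v₁ , v₂ , (v∈ , _ , p) , (_ , _ , q) , (_ , v₃ , r))))))) v≢ =
      XR⇒Xi v∈ v≢ , v₁ , v₂ , v₃ , liftR p , liftL q , liftR r
    join₄ (inj₂ (inj₂ (inj₁ (inj₂ (inj₂ (v₁ , (v∈ , _ , p) , (_ , v₂ , v₃ , q , r))))))) _ =
      XL⇒Xi v∈ , v₁ , v₂ , v₃ , liftL p , liftR q , liftR r
    join₄ (inj₂ (inj₂ (inj₂ (inj₂ (inj₂ (v₁ , (v∈ , _ , p) , (_ , v₂ , v₃ , q , r))))))) v≢ =
      XR⇒Xi v∈ v≢ , v₁ , v₂ , v₃ , liftR p , liftL q , liftL r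

    eq₄ : EqMinus1 (a4 (AI x y)) (a4 (AL x y)) (a4 (AR x y)) (a4 (Ā x y)) v''
    eq₄ = EqMinus1-intro (Xi⇒≢v'' ∘ proj₁) split₄ join₄

    eq₆ : EqMinus1 (a6 (AI x y)) (a6 (AL x y)) (a6 (AR x y)) (a6 (Ā x y)) v''
    eq₆ = EqMinus1-intro (Xi⇒≢v'' ∘ proj₁) split₆ join₆
      where
      split₆ : ∀ {v} → a6 (AI x y) v → a6 (AL x y) v ⊎ a6 (AR x y) v ⊎ a6 (Ā x y) v
      split₆ (v∈ , w , p) with splitI p
      ... | inj₁ p = inj₁ (Xi⇒XL v∈ , w , p)
      ... | inj₂ p = inj₂ (inj₁ (start∈XR p v∈ , w , p))

      join₆ : ∀ {v} → a6 (AL x y) v ⊎ a6 (AR x y) v ⊎ a6 (Ā x y) v → v ≢ v'' → a6 (AI x y) v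
      join₆ (inj₁ (v∈ , w , p))        _  = XL⇒Xi v∈ , w , liftL p
      join₆ (inj₂ (inj₁ (v∈ , w , p))) v≢ = XR⇒Xi v∈ v≢ , w , liftR p

    eq₈ : EqMinus2 (a8 (AI x y)) (a8 (AL x y)) (a8 (AR x y)) (a8 (Ā x y)) v''
    eq₈ = EqMinus2-intro (λ a → Xi⇒≢v'' (proj₁ a) , Xi⇒≢v'' (proj₁ (proj₂ a))) split₈ join₈
      where
      split₈ : ∀ {u w} → a8 (AI x y) u w → a8 (AL x y) u w ⊎ a8 (AR x y) u w ⊎ a8 (Ā x y) u w
      split₈ (u∈ , w∈ , p) with splitI p
      ... | inj₁ p = inj₁ (Xi⇒XL u∈ , Xi⇒XL w∈ , p)
      ... | inj₂ p = inj₂ (inj₁ (start∈XR p u∈ , end∈XR p w∈ , p))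

      join₈ : ∀ {u w} → a8 (AL x y) u w ⊎ a8 (AR x y) u w ⊎ a8 (Ā x y) u w →
        u ≢ v'' → w ≢ v'' → a8 (AI x y) u w
      join₈ (inj₁ (u∈ , w∈ , p))        _  _  = XL⇒Xi u∈ , XL⇒Xi w∈ , liftL p
      join₈ (inj₂ (inj₁ (u∈ , w∈ , p))) u≢ w≢ = XR⇒Xi u∈ u≢ , XR⇒Xi w∈ w≢ , liftR p

  eq₅ : ∀ x y → EqMinus1 (a5 (AI x y)) (a5 (AL x y)) (a5 (AR x y)) (a5 (Ā x y)) v''
  eq₅ x y = EqMinus1-congĀ Ā⁴⇔Ā⁵ (eq₄ y x)
    where
    Ā⁴⇔Ā⁵ : ∀ v → a4 (Ā y x) v ⇔ a5 (Ā x y) v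
    Ā⁴⇔Ā⁵ v = mk⇔ (Data.Sum.map (bar4-swap⇒bar5 x y) (bar4-swap⇒bar5 x y))
                   (Data.Sum.map (bar5⇒bar4-swap x y) (bar5⇒bar4-swap x y))

  -- A^(2), A^(7), A^(9) are A^(1), A^(6), A^(8) with the two colours swapped.
  recurrence : ∀ x y → Recurrence (AI x y) (AL x y) (AR x y) v''
  recurrence x y = eq₁ x y , eq₁ y x , eq₃ x y , eq₄ x y , eq₅ x y , eq₆ x y , eq₆ y x , eq₈ x y , eq₈ y x

lemma3p2 : (n m k c : ℕ) (ends : Fin m → Fin n × Fin n) → IsSimpleGraph ends →
    (T : Tree n) → IsSmoothTreeDecomposition ends k T →
    (rep : Fin m → Pos T) → IsRep ends T rep →
    (i L R : Pos T) → ChildOf L i → ChildOf R i → L ≢ R →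
    (v' v'' : Fin n) →
    bagAt L ≡ bagAt i → bagAt i ─ bagAt R ≡ ⁅ v' ⁆ → bagAt R ─ bagAt i ≡ ⁅ v'' ⁆ →
    (f : PartialColoring (E' rep i) c) →
    (fL : PartialColoring (E' rep L) c) → (fR : PartialColoring (E' rep R) c) →
    (∀ e hL hi → fL e hL ≡ f e hi) → (∀ e hR hi → fR e hR ≡ f e hi) →
    (c₁ c₂ : Fin c) →
    Recurrence (N ends (bagAt i) (E' rep i) f c₁ c₂)
               (N ends (bagAt L) (E' rep L) fL c₁ c₂)
               (N ends (bagAt R) (E' rep R) fR c₁ c₂) v''
lemma3p2 _ _ _ _ _ _ _ decomposition _ isRep _ _ _ L∈i R∈i L≢R _ _ XL≡Xi _ XR─Xi≡v'' _ _ _ fL≗f fR≗f c₁ c₂ =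
  InternalNode.recurrence (IsSmoothTreeDecomposition.isTD decomposition) isRep L∈i R∈i L≢R XL≡Xi XR─Xi≡v'' fL≗f fR≗f c₁ c₂
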